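{- Let $f$ be a Boolean network, $\mathcal{X}\subseteq\mathrm{var}(f)$, $g$ the Boolean network obtained from $f$ and $\mathcal{X}$ by the perturbation transformation, and $\Delta=\bigcup_{v\in\mathcal{X}}\{v^k,v^o\}$. Let $m$ be a trap space of $g$ with $m(u)\neq\star$ for every $u\in\Delta$. Let $\sigma$ be the perturbation on $\mathcal{X}$ defined by: $\sigma(v)=1$ iff $m(v^k)=0$ and $m(v^o)=1$; $\sigma(v)=0$ iff $m(v^k)=1$ and $m(v^o)=0$; $\sigma(v)=\star$ iff $m(v^k)=0$ and $m(v^o)=0$. Then the sub-space $m'$ of $f$ given by $m'(v)=m(v)$ for all $v\in\mathrm{var}(f)$ is a trap space of $f^\sigma$.
   Context: A Boolean network (BN) $f$ has a finite variable set $\mathrm{var}(f)$ and for each $v$ a Boolean function $f_v$ over $\mathrm{var}(f)$. A sub-space is a map $m:\mathrm{var}(f)\to\{0,1,\star\}$ representing $S[m]=\{s\in\{0,1\}^{\mathrm{var}(f)}: s_v=m(v)\text{ whenever }m(v)\ne\star\}$. A trap space is a sub-space $m$ such that for every $s\in S[m]$ and every $v$ with $m(v)\ne\star$, $f_v(s)=m(v)$. A perturbation on $\mathcal{X}$ is a map $\sigma:\mathcal{X}\to\{0,1,\star\}$; the perturbed BN $f^\sigma$ has $\mathrm{var}(f^\sigma)=\mathrm{var}(f)$, $f^\sigma_v=\sigma(v)$ (constant) if $v\in\mathcal{X}$ and $\sigma(v)\neq\star$, and $f^\sigma_v=f_v$ otherwise. Perturbation transformation: $g$ has variables $\mathrm{var}(f)\cup\Delta$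 (with $v^k,v^o$ fresh), $g_v=f_v$ for $v\in\mathrm{var}(f)\setminus\mathcal{X}$, and for $v\in\mathcal{X}$: $g_v=\neg v^k\wedge(v^o\vee f_v)$, $g_{v^k}=v^k$, $g_{v^o}=v^o\wedge\neg v^k$. -}

module Defs where

open import Data.Nat using (ℕ)
open import Data.Fin using (Fin)
open import Data.Fin.Subset using (Subset; _∈_)
open import Data.Fin.Subset.Properties using (_∈?_)
open import Data.Bool using (Bool; true; false; not; _∧_; _∨_)
open import Data.Maybe using (Maybe; just; nothing)
open import Relation.Nullary using (yes; no)
open import Relation.Binary.PropositionalEquality using (_≡_)

State : Set → Set
State V = V → Bool

BN : Set → Set
BN V = State V → V → Bool

-- Sub-space: just b = fixed to b, nothing = ⋆.
SubSpace : Set → Set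
SubSpace V = V → Maybe Bool

_∈S_ : {V : Set} → State V → SubSpace V → Set
s ∈S m = ∀ v b → m v ≡ just b → s v ≡ b

IsTrapSpace : {V : Set} → BN V → SubSpace V → Set
IsTrapSpace f m = ∀ s → s ∈S m → ∀ v b → m v ≡ just b → f s v ≡ b

Perturbation : {n : ℕ} → Subset n → Set
Perturbation {n} X = (v : Fin n) → v ∈ X → Maybe Bool

perturb : {n : ℕ} → BN (Fin n) → (X : Subset n) → Perturbation X → BN (Fin n)
perturb f X σ s v with v ∈? X
... | no _ = f s v
... | yes p with σ v p
...   | just b = b
...   | nothing = f s v

data GVar {n : ℕ} (X : Subset n) : Set where
  orig : Fin n → GVar X
  vk   : (v : Fin n) → v ∈ X → GVar X
  vo   : (v : Fin n) → v ∈ X → GVar X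

restrict : {n : ℕ} {X : Subset n} → State (GVar X) → State (Fin n)
restrict s v = s (orig v)

transform : {n : ℕ} → BN (Fin n) → (X : Subset n) → BN (GVar X)
transform f X s (orig v) with v ∈? X
... | no _  = f (restrict s) v
... | yes p = not (s (vk v p)) ∧ (s (vo v p) ∨ f (restrict s) v)
transform f X s (vk v p) = s (vk v p)
transform f X s (vo v p) = s (vo v p) ∧ not (s (vk v p))

module Submission where

open import Defs
open import Data.Nat using (ℕ)
open import Data.Fin using (Fin)
open import Data.Fin.Subset using (Subset; _∈_)
open import Data.Fin.Subset.Properties using (_∈?_)
open import Data.Bool using (Bool; true; false; not; _∧_; _∨_)
open import Data.Maybe using (Maybe; just; nothing; fromMaybe)
open import Data.Maybe.Properties using (just-injective)
open import Data.Product using (_×_; _,_; proj₁; proj₂)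
open import Function.Bundles using (_⇔_; Equivalence)
open import Relation.Nullary using (¬_; yes; no)
open import Relation.Binary.PropositionalEquality using (_≡_; refl; sym; trans)

-- A state of f in m' lifts to a state of g in m by giving v^k, v^o the values
-- fixed by m, which encode σ(v).  On such a state g_v = ¬v^k ∧ (v^o ∨ f_v) is
-- exactly f^σ_v, so the trap property of m for g transfers to m' for f^σ.

controlBits : Maybe Bool → Bool × Bool
controlBits (just true)  = false , true
controlBits (just false) = true , false
controlBits nothing      = false , false

EncodesPerturbation : {n : ℕ} {X : Subset n} → SubSpace (GVar X) → Perturbation X → Set
EncodesPerturbation m σ =
  ∀ v p → m (vk v p) ≡ just (proj₁ (controlBits (σ v p)))
        × m (vo v p) ≡ just (proj₂ (controlBits (σ v p)))

encodesPerturbation : {n : ℕ} {X : Subset n} (m : SubSpace (GVar X)) (σ : Perturbation X) →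
  (∀ v (p : v ∈ X) →
     (σ v p ≡ just true ⇔ (m (vk v p) ≡ just false × m (vo v p) ≡ just true)) ×
     (σ v p ≡ just false ⇔ (m (vk v p) ≡ just true × m (vo v p) ≡ just false)) ×
     (σ v p ≡ nothing ⇔ (m (vk v p) ≡ just false × m (vo v p) ≡ just false))) →
  EncodesPerturbation m σ
encodesPerturbation m σ hσ v p with σ v p in eq
... | just true  = Equivalence.to (proj₁ (hσ v p)) eq
... | just false = Equivalence.to (proj₁ (proj₂ (hσ v p))) eq
... | nothing    = Equivalence.to (proj₂ (proj₂ (hσ v p))) eq

control-override : ∀ c y → not (proj₁ (controlBits c)) ∧ (proj₂ (controlBits c) ∨ y) ≡ fromMaybe y c
control-override (just true)  y = refl
control-override (just false) y = refl
control-override nothing      y = refl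

lift : {n : ℕ} {X : Subset n} → Perturbation X → State (Fin n) → State (GVar X)
lift σ s (orig v) = s v
lift σ s (vk v p) = proj₁ (controlBits (σ v p))
lift σ s (vo v p) = proj₂ (controlBits (σ v p))

lift-∈S : {n : ℕ} {X : Subset n} {m : SubSpace (GVar X)} {σ : Perturbation X} →
  EncodesPerturbation m σ → ∀ s → s ∈S (λ v → m (orig v)) → lift σ s ∈S m
lift-∈S enc s s∈ (orig v) b e = s∈ v b e
lift-∈S enc s s∈ (vk v p) b e = just-injective (trans (sym (proj₁ (enc v p))) e)
lift-∈S enc s s∈ (vo v p) b e = just-injective (trans (sym (proj₂ (enc v p))) e)

transform-lift : {n : ℕ} (f : BN (Fin n)) (X : Subset n) (σ : Perturbation X) →
  ∀ s v → transform f X (lift σ s) (orig v) ≡ perturb f X σ s v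
transform-lift f X σ s v with v ∈? X
... | no _  = refl
... | yes p with σ v p
...   | just b  = control-override (just b) (f s v)
...   | nothing = refl

lemma2 : {n : ℕ} (f : BN (Fin n)) (X : Subset n) (m : SubSpace (GVar X)) →
    IsTrapSpace (transform f X) m →
    (∀ v (p : v ∈ X) → ¬ (m (vk v p) ≡ nothing)) →
    (∀ v (p : v ∈ X) → ¬ (m (vo v p) ≡ nothing)) →
    (σ : Perturbation X) →
    (∀ v (p : v ∈ X) →
    (σ v p ≡ just true ⇔ (m (vk v p) ≡ just false × m (vo v p) ≡ just true)) ×
    (σ v p ≡ just false ⇔ (m (vk v p) ≡ just true × m (vo v p) ≡ just false)) ×
    (σ v p ≡ nothing ⇔ (m (vk v p) ≡ just false × m (vo v p) ≡ just false))) →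
    IsTrapSpace (perturb f X σ) (λ v → m (orig v))
lemma2 f X m trap _ _ σ hσ s s∈ v b e =
  trans (sym (transform-lift f X σ s v))
        (trap (lift σ s) (lift-∈S (encodesPerturbation m σ hσ) s s∈) (orig v) b e)
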